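{- Let $\mathcal{F}$ be a fixed hypergraph on $k$ vertices and let $\mathcal{H}$ be a hypergraph on at least $k$ vertices. Then: (1) $\hat{\mathcal{H}}^{k+1}$ contains no edge-induced subhypergraph isomorphic to $\mathcal{F}$; (2) if $\mathcal{F}$ has at least one hyperedge, $\hat{\mathcal{H}}^{k+1}$ contains no restriction isomorphic to $\mathcal{F}$; (3) if there exists $\ell\le k$ such that $\mathcal{F}$ has strictly fewer than $\binom{k-1}{\ell-1}$ hyperedges of size $\ell$, then $\hat{\mathcal{H}}_{\ell}$ contains no subhypergraph isomorphic to $\mathcal{F}$.
   Context: A hypergraph $\mathcal{H}=(V,\mathcal{E})$ has $V$ finite and $\mathcal{E}\subseteq 2^V$. For $\mathcal{F}'\subseteq\mathcal{E}$, the edge-induced subhypergraph is $(\bigcup_{F\in\mathcal{F}'}F,\mathcal{F}')$. For $V'\subseteq V$, the subhypergraph induced by $V'$ is $(V',\{F\cap V'\mid F\in\mathcal{E},F\cap V'\neq\emptyset\})$ and the restriction to $V'$ is $(V',\{F\in\mathcal{E}\mid F\subseteq V'\})$. For an integer $m$: $\hat{\mathcal{H}}^{m}=(V\cup\{x_1,\dots,x_m\},\{E\cup\{x_1,\dots,x_m\}\mid E\in\mathcal{E}\})$ with $x_1,\dots,x_m$ new vertices; $\hat{\mathcal{H}}_{m}=(V\cup\{x\},\ \mathcal{E}\cup\{X\cup\{x\}\mid X\subseteq V,\ |X|=m\})$ with $x$ a new vertex. -}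

module Defs where

open import Data.Nat using (ℕ; zero; suc; _+_; _≡ᵇ_)
open import Data.Bool using (Bool; true; false; _∧_)
open import Data.Fin using (Fin)
open import Data.Fin.Subset using (Subset; _∈_; _⊆_; ⊤; ⊥; ⁅_⁆; _∩_; _∪_; ∣_∣; Nonempty)
open import Data.Vec using (Vec; []; _∷_; _++_; replicate)
open import Data.List using (List; []; _∷_; map; filterᵇ; length; foldr) renaming (_++_ to _++ₗ_)
open import Data.List.Relation.Unary.All using (All)
import Data.List.Membership.Propositional as LMem
open import Data.Product using (Σ; ∃; _×_)
open import Data.Sum using (_⊎_)
open import Relation.Binary.PropositionalEquality using (_≡_)

record Hypergraph (n : ℕ) : Set where
  field
    edge : Subset n → Bool
open Hypergraph public

-- A hypergraph whose vertex set is a subset `verts` of Fin N (used for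
-- constructed hypergraphs and their subhypergraphs); edges given as a predicate.
record SubHG (N : ℕ) : Set₁ where
  field
    verts : Subset N
    isEdge : Subset N → Set
open SubHG public

asSub : ∀ {n} → Hypergraph n → SubHG n
asSub H = record { verts = ⊤ ; isEdge = λ E → edge H E ≡ true }

image : ∀ {k N} → (Fin k → Fin N) → Subset k → Subset N
image {zero}  φ []      = ⊥
image {suc k} φ (b ∷ S) = (if b then ⁅ φ Fin.zero ⁆ else ⊥) ∪ image (λ i → φ (Fin.suc i)) S
  where open import Data.Bool using (if_then_else_)

record _≅_ {k N : ℕ} (F : Hypergraph k) (G : SubHG N) : Set where
  field
    φ      : Fin k → Fin N
    inj    : ∀ i j → φ i ≡ φ j → i ≡ j
    into   : ∀ i → φ i ∈ verts G
    onto   : ∀ v → v ∈ verts G → ∃ λ i → φ i ≡ v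
    edge→  : ∀ S → edge F S ≡ true → isEdge G (image φ S)
    edge←  : ∀ T → isEdge G T → Σ (Subset k) λ S → (edge F S ≡ true) × (T ≡ image φ S)

-- Ĥ^m : add new vertices x₁..xₘ (indices n..n+m-1) to every edge
hatUp : ∀ {n} (m : ℕ) → Hypergraph n → SubHG (n + m)
hatUp {n} m H = record
  { verts = ⊤
  ; isEdge = λ U → Σ (Subset n) λ E → (edge H E ≡ true) × (U ≡ E ++ replicate m true) }

-- Ĥ_m : add one new vertex x (index n) and all edges X ∪ {x} with X ⊆ V, |X| = m
hatLow : ∀ {n} (m : ℕ) → Hypergraph n → SubHG (n + 1)
hatLow {n} m H = record
  { verts = ⊤
  ; isEdge = λ U →
      (Σ (Subset n) λ E → (edge H E ≡ true) × (U ≡ E ++ (false ∷ [])))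
    ⊎ (Σ (Subset n) λ X → (∣ X ∣ ≡ m) × (U ≡ X ++ (true ∷ []))) }

edgeInduced : ∀ {N} → SubHG N → List (Subset N) → SubHG N
edgeInduced G Fs = record
  { verts = foldr _∪_ ⊥ Fs
  ; isEdge = λ T → T LMem.∈ Fs }

induced : ∀ {N} → SubHG N → Subset N → SubHG N
induced G V' = record
  { verts = V'
  ; isEdge = λ T → Nonempty T × (Σ (Subset _) λ E → isEdge G E × (T ≡ E ∩ V')) }

restriction : ∀ {N} → SubHG N → Subset N → SubHG N
restriction G V' = record
  { verts = V'
  ; isEdge = λ T → isEdge G T × (T ⊆ V') }

HasEdgeInducedCopy : ∀ {k N} → SubHG N → Hypergraph k → Set
HasEdgeInducedCopy G F =
  Σ (List (Subset _)) λ Fs → All (isEdge G) Fs × (F ≅ edgeInduced G Fs)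

HasInducedCopy : ∀ {k N} → SubHG N → Hypergraph k → Set
HasInducedCopy G F = Σ (Subset _) λ V' → (V' ⊆ verts G) × (F ≅ induced G V')

HasRestrictionCopy : ∀ {k N} → SubHG N → Hypergraph k → Set
HasRestrictionCopy G F = Σ (Subset _) λ V' → (V' ⊆ verts G) × (F ≅ restriction G V')

allSubsets : (n : ℕ) → List (Subset n)
allSubsets zero    = [] ∷ []
allSubsets (suc n) = map (false ∷_) (allSubsets n) ++ₗ map (true ∷_) (allSubsets n)

numEdgesOfSize : ∀ {k} → ℕ → Hypergraph k → ℕ
numEdgesOfSize {k} ℓ F = length (filterᵇ (λ S → edge F S ∧ (∣ S ∣ ≡ᵇ ℓ)) (allSubsets k))

HasEdge : ∀ {k} → Hypergraph k → Set
HasEdge {k} F = Σ (Subset k) λ S → edge F S ≡ true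

{-# OPTIONS --safe #-}
-- A copy of F spans exactly k vertices. Every edge of Ĥ^{k+1} contains all k+1 new vertices, so
-- an edge-induced copy with k ≥ 1 or a restriction copy containing an edge would need k+1 vertices.
-- For an induced copy of F on V′ in Ĥ_ℓ, |V′| = k ≤ n leaves a vertex v ∉ V′. If the new vertex x
-- lies in V′, every ℓ-set T ⊆ V′ through x is ({v} ∪ T) ∩ V′ for the added edge {v} ∪ T; if x ∉ V′,
-- every ℓ-set T ⊆ V′ is ({x} ∪ T) ∩ V′. Either way all (k-1 choose ℓ-1) ℓ-sets of F through some
-- vertex are edges of F.
module Submission where

open import Defs
open import Data.Nat using (ℕ; zero; suc; _+_; _∸_; _≤_; _<_; z≤n; s≤s)
open import Data.Nat.Properties
  using (≤-refl; ≤-trans; ≤-reflexive; ≤-<-trans; <⇒≱; m<m+n; m≤m+n; m≤n+m; +-mono-≤; +-comm; suc-injective; ≡⇒≡ᵇ)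
open import Data.Nat.Combinatorics using (_C_; nCk+nC[k+1]≡[n+1]C[k+1])
open import Data.Bool using (Bool; true; false; T; T?; if_then_else_)
open import Data.Bool.Properties using (T-≡; T-∧)
open import Data.Fin using (Fin; _↑ʳ_)
import Data.Fin.Properties as FinP
open import Data.Fin.Subset
  using (Subset; inside; outside; _∈_; _∉_; _⊆_; ⊤; ⊥; ⁅_⁆; _∩_; _∪_; ∣_∣; Nonempty)
open import Data.Fin.Subset.Properties
  using ( _∈?_; ∉⊥; ∈⊤; ∣⊥∣≡0; ∣⊤∣≡n; x∈⁅x⁆; x∈⁅y⁆⇒x≡y; ⊆-refl; ⊆-trans; ⊆-antisym
        ; p⊆q⇒∣p∣≤∣q∣; out⊆; drop-there; x∈p∩q⁺; x∈p∩q⁻; x∈p∪q⁺; x∈p∪q⁻; p⊆p∪q; ∪-identityˡ)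
open import Data.Vec using ([]; _∷_; here; there; splitAt) renaming (_++_ to _++ᵥ_)
open import Data.List using (List; []; _∷_; map; filterᵇ; length) renaming (_++_ to _++ₗ_)
open import Data.List.Properties using (length-++; filter-++)
open import Data.List.Relation.Unary.All using (_∷_)
open import Data.Product using (∃; _×_; _,_)
import Data.Product as Product
open import Data.Sum using (inj₁; inj₂)
open import Function using (_∘_; id)
open import Function.Bundles using (Equivalence)
open import Function.Definitions using (Injective)
open import Relation.Nullary using (¬_; yes; no; contradiction)
open import Relation.Binary.PropositionalEquality
  using (_≡_; refl; sym; trans; cong; cong₂; subst; module ≡-Reasoning)

∣p++q∣≡∣p∣+∣q∣ : ∀ {m n} (p : Subset m) (q : Subset n) → ∣ p ++ᵥ q ∣ ≡ ∣ p ∣ + ∣ q ∣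
∣p++q∣≡∣p∣+∣q∣ []            q = refl
∣p++q∣≡∣p∣+∣q∣ (inside ∷ p)  q = cong suc (∣p++q∣≡∣p∣+∣q∣ p q)
∣p++q∣≡∣p∣+∣q∣ (outside ∷ p) q = ∣p++q∣≡∣p∣+∣q∣ p q

∣⁅x⁆∪p∣≡1+∣p∣ : ∀ {n} {x : Fin n} {p : Subset n} → x ∉ p → ∣ ⁅ x ⁆ ∪ p ∣ ≡ suc ∣ p ∣
∣⁅x⁆∪p∣≡1+∣p∣ {x = Fin.zero}  {outside ∷ p} _   = cong (suc ∘ ∣_∣) (∪-identityˡ p)
∣⁅x⁆∪p∣≡1+∣p∣ {x = Fin.zero}  {inside ∷ p}  x∉p = contradiction here x∉p
∣⁅x⁆∪p∣≡1+∣p∣ {x = Fin.suc x} {outside ∷ p} x∉p = ∣⁅x⁆∪p∣≡1+∣p∣ (x∉p ∘ there)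
∣⁅x⁆∪p∣≡1+∣p∣ {x = Fin.suc x} {inside ∷ p}  x∉p = cong suc (∣⁅x⁆∪p∣≡1+∣p∣ (x∉p ∘ there))

∣p∣<n⇒∃∉ : ∀ {n} {p : Subset n} → ∣ p ∣ < n → ∃ λ x → x ∉ p
∣p∣<n⇒∃∉ {p = outside ∷ p} _ = Fin.zero , λ ()
∣p∣<n⇒∃∉ {p = inside ∷ p} (s≤s ∣p∣<n) = Product.map Fin.suc (_∘ drop-there) (∣p∣<n⇒∃∉ ∣p∣<n)

[⁅x⁆∪p]∩q≡p : ∀ {n} {x : Fin n} {p q : Subset n} → p ⊆ q → x ∉ q → (⁅ x ⁆ ∪ p) ∩ q ≡ p
[⁅x⁆∪p]∩q≡p {x = x} {p} {q} p⊆q x∉q = ⊆-antisym ⊆p (λ y∈p → x∈p∩q⁺ (x∈p∪q⁺ (inj₂ y∈p) , p⊆q y∈p))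
  where
  ⊆p : (⁅ x ⁆ ∪ p) ∩ q ⊆ p
  ⊆p {y} y∈ with x∈p∩q⁻ (⁅ x ⁆ ∪ p) q y∈
  ... | y∈⁅x⁆∪p , y∈q with x∈p∪q⁻ ⁅ x ⁆ p y∈⁅x⁆∪p
  ...   | inj₁ y∈⁅x⁆ = contradiction (subst (_∈ q) (x∈⁅y⁆⇒x≡y x y∈⁅x⁆) y∈q) x∉q
  ...   | inj₂ y∈p   = y∈p

∈-image⁺ : ∀ {k N} (φ : Fin k → Fin N) {S i} → i ∈ S → φ i ∈ image φ S
∈-image⁺ φ {inside ∷ S} here        = x∈p∪q⁺ (inj₁ (x∈⁅x⁆ (φ Fin.zero)))
∈-image⁺ φ {s ∷ S}      (there i∈S) = x∈p∪q⁺ (inj₂ (∈-image⁺ (φ ∘ Fin.suc) i∈S))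

∈-image⁻ : ∀ {k N} (φ : Fin k → Fin N) S {v} → v ∈ image φ S → ∃ λ i → i ∈ S × φ i ≡ v
∈-image⁻ φ []      v∈ = contradiction v∈ ∉⊥
∈-image⁻ φ (s ∷ S) v∈ with x∈p∪q⁻ (if s then ⁅ φ Fin.zero ⁆ else ⊥) _ v∈
∈-image⁻ φ (inside ∷ S)  _ | inj₁ v∈⁅φ0⁆ = Fin.zero , here , sym (x∈⁅y⁆⇒x≡y _ v∈⁅φ0⁆)
∈-image⁻ φ (outside ∷ S) _ | inj₁ v∈⊥    = contradiction v∈⊥ ∉⊥
∈-image⁻ φ (s ∷ S)       _ | inj₂ v∈φS   =
  Product.map Fin.suc (Product.map there id) (∈-image⁻ (φ ∘ Fin.suc) S v∈φS)

∣image∣≡∣S∣ : ∀ {k N} {φ : Fin k → Fin N} → Injective _≡_ _≡_ φ → ∀ S → ∣ image φ S ∣ ≡ ∣ S ∣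
∣image∣≡∣S∣ {N = N} φ-inj []            = ∣⊥∣≡0 N
∣image∣≡∣S∣ {φ = φ} φ-inj (outside ∷ S) =
  trans (cong ∣_∣ (∪-identityˡ (image (φ ∘ Fin.suc) S))) (∣image∣≡∣S∣ (FinP.suc-injective ∘ φ-inj) S)
∣image∣≡∣S∣ {φ = φ} φ-inj (inside ∷ S)  =
  trans (∣⁅x⁆∪p∣≡1+∣p∣ φ0∉φS) (cong suc (∣image∣≡∣S∣ (FinP.suc-injective ∘ φ-inj) S))
  where
  φ0∉φS : φ Fin.zero ∉ image (φ ∘ Fin.suc) S
  φ0∉φS φ0∈φS with ∈-image⁻ (φ ∘ Fin.suc) S φ0∈φS
  ... | _ , _ , φsi≡φ0 with φ-inj φsi≡φ0
  ... | ()

image-injective : ∀ {k N} {φ : Fin k → Fin N} → Injective _≡_ _≡_ φ → Injective _≡_ _≡_ (image φ)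
image-injective {φ = φ} φ-inj {S} {S′} φS≡φS′ = ⊆-antisym (⊆ φS≡φS′) (⊆ (sym φS≡φS′))
  where
  ⊆ : ∀ {A B} → image φ A ≡ image φ B → A ⊆ B
  ⊆ {A} {B} φA≡φB {i} i∈A with ∈-image⁻ φ B (subst (φ i ∈_) φA≡φB (∈-image⁺ φ i∈A))
  ... | j , j∈B , φj≡φi = subst (_∈ B) (φ-inj φj≡φi) j∈B

module _ {k N} {F : Hypergraph k} {G : SubHG N} (iso : F ≅ G) where
  open _≅_ iso

  φ-injective : Injective _≡_ _≡_ φ
  φ-injective = inj _ _

  image⊆verts : ∀ S → image φ S ⊆ verts G
  image⊆verts S v∈φS with ∈-image⁻ φ S v∈φS
  ... | i , _ , refl = into i

  ∣verts∣≡k : ∣ verts G ∣ ≡ k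
  ∣verts∣≡k = begin
    ∣ verts G ∣     ≡⟨ cong ∣_∣ (⊆-antisym verts⊆φ⊤ (image⊆verts ⊤)) ⟩
    ∣ image φ ⊤ ∣   ≡⟨ ∣image∣≡∣S∣ φ-injective ⊤ ⟩
    ∣ ⊤ {k} ∣       ≡⟨ ∣⊤∣≡n k ⟩
    k               ∎
    where
    open ≡-Reasoning
    verts⊆φ⊤ : verts G ⊆ image φ ⊤
    verts⊆φ⊤ v∈V with onto _ v∈V
    ... | i , refl = ∈-image⁺ φ ∈⊤

  ⊆verts⇒∣p∣≤k : ∀ {p} → p ⊆ verts G → ∣ p ∣ ≤ k
  ⊆verts⇒∣p∣≤k p⊆V = ≤-trans (p⊆q⇒∣p∣≤∣q∣ p⊆V) (≤-reflexive ∣verts∣≡k)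

  edge-reflected : ∀ S → isEdge G (image φ S) → edge F S ≡ true
  edge-reflected S φS-edge with edge← (image φ S) φS-edge
  ... | S′ , S′-edge , φS≡φS′ =
    subst (λ X → edge F X ≡ true) (sym (image-injective φ-injective φS≡φS′)) S′-edge

newVertices : ∀ n m → Subset (n + m)
newVertices n m = ⊥ {n} ++ᵥ ⊤ {m}

∣newVertices∣≡m : ∀ n m → ∣ newVertices n m ∣ ≡ m
∣newVertices∣≡m n m = trans (∣p++q∣≡∣p∣+∣q∣ (⊥ {n}) ⊤) (cong₂ _+_ (∣⊥∣≡0 n) (∣⊤∣≡n m))

⊥++p⊆q++p : ∀ {n m} (q : Subset n) (p : Subset m) → ⊥ ++ᵥ p ⊆ q ++ᵥ p
⊥++p⊆q++p []      p = ⊆-refl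
⊥++p⊆q++p (s ∷ q) p = out⊆ (⊥++p⊆q++p q p)

hatUp-edge⊇newVertices : ∀ {n} m (H : Hypergraph n) {U} → isEdge (hatUp m H) U → newVertices n m ⊆ U
hatUp-edge⊇newVertices m H (E , _ , refl) = ⊥++p⊆q++p E ⊤

module _ {k n m} (F : Hypergraph k) (H : Hypergraph n) (k<m : k < m) where

  private
    newVertices⊈copy : ∀ {G} → F ≅ G → ¬ (newVertices n m ⊆ verts G)
    newVertices⊈copy iso new⊆V =
      <⇒≱ k<m (≤-trans (≤-reflexive (sym (∣newVertices∣≡m n m))) (⊆verts⇒∣p∣≤k iso new⊆V))

  hatUp-no-edgeInducedCopy : 1 ≤ k → ¬ HasEdgeInducedCopy (hatUp m H) F
  hatUp-no-edgeInducedCopy 1≤k ([] , _ , iso) =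
    <⇒≱ 1≤k (≤-reflexive (trans (sym (∣verts∣≡k iso)) (∣⊥∣≡0 (n + m))))
  hatUp-no-edgeInducedCopy _ (U ∷ _ , U-edge ∷ _ , iso) =
    newVertices⊈copy iso (⊆-trans (hatUp-edge⊇newVertices m H U-edge) (p⊆p∪q _))

  hatUp-no-restrictionCopy : HasEdge F → ¬ HasRestrictionCopy (hatUp m H) F
  hatUp-no-restrictionCopy (S , S-edge) (_ , _ , iso) with _≅_.edge→ iso S S-edge
  ... | φS-edge , φS⊆V = newVertices⊈copy iso (⊆-trans (hatUp-edge⊇newVertices m H φS-edge) φS⊆V)

newVertex : ∀ n → Fin (n + 1)
newVertex n = n ↑ʳ Fin.zero

newVertex∉p++[outside] : ∀ {n} (p : Subset n) → newVertex n ∉ p ++ᵥ (outside ∷ [])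
newVertex∉p++[outside] []      ()
newVertex∉p++[outside] (s ∷ p) (there x∈) = newVertex∉p++[outside] p x∈

hatLow-edge : ∀ {n m} (H : Hypergraph n) {E} → newVertex n ∈ E → ∣ E ∣ ≡ suc m → isEdge (hatLow m H) E
hatLow-edge {n} H {E} x∈E ∣E∣≡1+m with splitAt n E
... | X , outside ∷ [] , refl = contradiction x∈E (newVertex∉p++[outside] X)
... | X , inside ∷ [] , refl =
  inj₂ (X , suc-injective (trans (+-comm 1 ∣ X ∣) (trans (sym (∣p++q∣≡∣p∣+∣q∣ X _)) ∣E∣≡1+m)) , refl)

induced-hatLow-edge : ∀ {n m} (H : Hypergraph n) {V′ T : Subset (n + 1)} {v} →
  Nonempty T → T ⊆ V′ → v ∉ V′ → newVertex n ∈ ⁅ v ⁆ ∪ T → ∣ T ∣ ≡ m →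
  isEdge (induced (hatLow m H) V′) T
induced-hatLow-edge H T≢∅ T⊆V′ v∉V′ x∈E ∣T∣≡m =
  T≢∅ , _ , hatLow-edge H x∈E (trans (∣⁅x⁆∪p∣≡1+∣p∣ (v∉V′ ∘ T⊆V′)) (cong suc ∣T∣≡m)) ,
  sym ([⁅x⁆∪p]∩q≡p T⊆V′ v∉V′)

module _ {k n ℓ} {F : Hypergraph (suc k)} {H : Hypergraph n} {V′} (1+k≤n : suc k ≤ n)
         (iso : F ≅ induced (hatLow ℓ H) V′) where
  open _≅_ iso

  private
    star-edge : ∀ {v S i} → v ∉ V′ → newVertex n ∈ ⁅ v ⁆ ∪ image φ S → i ∈ S → ∣ S ∣ ≡ ℓ →
                edge F S ≡ true
    star-edge {S = S} v∉V′ x∈E i∈S ∣S∣≡ℓ = edge-reflected iso S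
      (induced-hatLow-edge H (_ , ∈-image⁺ φ i∈S) (image⊆verts iso S) v∉V′ x∈E
        (trans (∣image∣≡∣S∣ (φ-injective iso) S) ∣S∣≡ℓ))

    ∣V′∣<n+1 : ∣ V′ ∣ < n + 1
    ∣V′∣<n+1 = ≤-<-trans (≤-trans (≤-reflexive (∣verts∣≡k iso)) 1+k≤n) (m<m+n n (s≤s z≤n))

  induced-hatLow-copy⇒star : ∃ λ i → ∀ S → i ∈ S → ∣ S ∣ ≡ ℓ → edge F S ≡ true
  induced-hatLow-copy⇒star with newVertex n ∈? V′
  ... | yes x∈V′ =
    let i , φi≡x = onto _ x∈V′ ; v , v∉V′ = ∣p∣<n⇒∃∉ ∣V′∣<n+1 in
    i , λ S i∈S → star-edge v∉V′ (x∈p∪q⁺ (inj₂ (subst (_∈ image φ S) φi≡x (∈-image⁺ φ i∈S)))) i∈S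
  ... | no x∉V′ = Fin.zero , λ S → star-edge x∉V′ (x∈p∪q⁺ (inj₁ (x∈⁅x⁆ _)))

count : ∀ {A : Set} → (A → Bool) → List A → ℕ
count P xs = length (filterᵇ P xs)

count-++ : ∀ {A : Set} (P : A → Bool) xs ys → count P (xs ++ₗ ys) ≡ count P xs + count P ys
count-++ P xs ys = trans (cong length (filter-++ (T? ∘ P) xs ys)) (length-++ (filterᵇ P xs))

count-map : ∀ {A B : Set} (P : B → Bool) (f : A → B) xs → count P (map f xs) ≡ count (P ∘ f) xs
count-map P f []       = refl
count-map P f (x ∷ xs) with P (f x)
... | true  = cong suc (count-map P f xs)
... | false = count-map P f xs

count-allSubsets-suc : ∀ {k} (P : Subset (suc k) → Bool) →
  count P (allSubsets (suc k))
  ≡ count (P ∘ (inside ∷_)) (allSubsets k) + count (P ∘ (outside ∷_)) (allSubsets k)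
count-allSubsets-suc {k} P = begin
  count P (map (outside ∷_) (allSubsets k) ++ₗ map (inside ∷_) (allSubsets k))
    ≡⟨ count-++ P (map (outside ∷_) (allSubsets k)) _ ⟩
  count P (map (outside ∷_) (allSubsets k)) + count P (map (inside ∷_) (allSubsets k))
    ≡⟨ cong₂ _+_ (count-map P (outside ∷_) (allSubsets k)) (count-map P (inside ∷_) (allSubsets k)) ⟩
  count (P ∘ (outside ∷_)) (allSubsets k) + count (P ∘ (inside ∷_)) (allSubsets k)
    ≡⟨ +-comm (count (P ∘ (outside ∷_)) (allSubsets k)) _ ⟩
  count (P ∘ (inside ∷_)) (allSubsets k) + count (P ∘ (outside ∷_)) (allSubsets k) ∎
  where open ≡-Reasoning

module _ {k} (P : Subset (suc k) → Bool) where
  private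
    ≤count : count (P ∘ (inside ∷_)) (allSubsets k) + count (P ∘ (outside ∷_)) (allSubsets k)
             ≤ count P (allSubsets (suc k))
    ≤count = ≤-reflexive (sym (count-allSubsets-suc P))

  count-allSubsets-suc≥inside : count (P ∘ (inside ∷_)) (allSubsets k) ≤ count P (allSubsets (suc k))
  count-allSubsets-suc≥inside = ≤-trans (m≤m+n _ _) ≤count

  count-allSubsets-suc≥outside : count (P ∘ (outside ∷_)) (allSubsets k) ≤ count P (allSubsets (suc k))
  count-allSubsets-suc≥outside = ≤-trans (m≤n+m _ _) ≤count

  count-allSubsets-suc-mono : ∀ {a b} → a ≤ count (P ∘ (inside ∷_)) (allSubsets k) →
    b ≤ count (P ∘ (outside ∷_)) (allSubsets k) → a + b ≤ count P (allSubsets (suc k))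
  count-allSubsets-suc-mono a≤ b≤ = ≤-trans (+-mono-≤ a≤ b≤) ≤count

C≤count-allSubsets : ∀ k m (P : Subset k → Bool) → (∀ S → ∣ S ∣ ≡ m → T (P S)) → k C m ≤ count P (allSubsets k)
C≤count-allSubsets zero    zero    P all with P [] | all [] refl
... | true | _ = s≤s z≤n
C≤count-allSubsets zero    (suc m) P all = z≤n
C≤count-allSubsets (suc k) zero    P all =
  ≤-trans (C≤count-allSubsets k zero (P ∘ (outside ∷_)) (all ∘ (outside ∷_))) (count-allSubsets-suc≥outside P)
C≤count-allSubsets (suc k) (suc m) P all =
  subst (_≤ count P (allSubsets (suc k))) (nCk+nC[k+1]≡[n+1]C[k+1] k m)
    (count-allSubsets-suc-mono P
      (C≤count-allSubsets k m (P ∘ (inside ∷_)) (λ S → all (inside ∷ S) ∘ cong suc))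
      (C≤count-allSubsets k (suc m) (P ∘ (outside ∷_)) (all ∘ (outside ∷_))))

C≤count-allSubsets-∋ : ∀ k m (P : Subset (suc k) → Bool) (i : Fin (suc k)) →
  (∀ S → i ∈ S → ∣ S ∣ ≡ suc m → T (P S)) → k C m ≤ count P (allSubsets (suc k))
C≤count-allSubsets-∋ k m P Fin.zero all =
  ≤-trans (C≤count-allSubsets k m (P ∘ (inside ∷_)) (λ S → all (inside ∷ S) here ∘ cong suc))
          (count-allSubsets-suc≥inside P)
C≤count-allSubsets-∋ (suc k) zero P (Fin.suc i) all =
  ≤-trans (C≤count-allSubsets-∋ k zero (P ∘ (outside ∷_)) i (λ S → all (outside ∷ S) ∘ there))
          (count-allSubsets-suc≥outside P)
C≤count-allSubsets-∋ (suc k) (suc m) P (Fin.suc i) all =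
  subst (_≤ count P (allSubsets (suc (suc k)))) (nCk+nC[k+1]≡[n+1]C[k+1] k m)
    (count-allSubsets-suc-mono P
      (C≤count-allSubsets-∋ k m (P ∘ (inside ∷_)) i (λ S i∈S → all (inside ∷ S) (there i∈S) ∘ cong suc))
      (C≤count-allSubsets-∋ k (suc m) (P ∘ (outside ∷_)) i (λ S → all (outside ∷ S) ∘ there)))

hatLow-no-inducedCopy : ∀ {k n} (F : Hypergraph k) (H : Hypergraph n) → k ≤ n →
  (ℓ : ℕ) → 1 ≤ ℓ → ℓ ≤ k → numEdgesOfSize ℓ F < (k ∸ 1) C (ℓ ∸ 1) → ¬ HasInducedCopy (hatLow ℓ H) F
hatLow-no-inducedCopy {suc k} F H k≤n (suc m) _ _ few (_ , _ , iso)
  with induced-hatLow-copy⇒star k≤n iso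
... | i , star = <⇒≱ few (C≤count-allSubsets-∋ k m _ i λ S i∈S ∣S∣≡ℓ →
  Equivalence.from T-∧ (Equivalence.from T-≡ (star S i∈S ∣S∣≡ℓ) , ≡⇒≡ᵇ _ _ ∣S∣≡ℓ))

lemma7 : (k : ℕ) (F : Hypergraph k) (n : ℕ) (H : Hypergraph n) → k ≤ n →
    ((1 ≤ k) → ¬ HasEdgeInducedCopy (hatUp (suc k) H) F)
    × (HasEdge F → ¬ HasRestrictionCopy (hatUp (suc k) H) F)
    × ((ℓ : ℕ) → 1 ≤ ℓ → ℓ ≤ k → numEdgesOfSize ℓ F < (k ∸ 1) C (ℓ ∸ 1) →
        ¬ HasInducedCopy (hatLow ℓ H) F)
lemma7 k F n H k≤n =
    hatUp-no-edgeInducedCopy F H ≤-refl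
  , hatUp-no-restrictionCopy F H ≤-refl
  , hatLow-no-inducedCopy F H k≤n
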